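{- Let $\mathbb{K}$ be a non-trivial class of MTL-chains (i.e. $\mathbb{K}$ contains an MTL-chain with at least two elements), and let $\varphi$ be a sentence that is a lattice combination of literals. Then the following are equivalent: (1) $\varphi$ is a classical propositional contradiction (treating distinct atomic sentences as distinct propositional variables); (2) $\varphi^\star\in\mathrm{TAUT}_0(\mathbb{K})$.
   Context: An MTL-chain is a linearly ordered algebra $\mathbf{A}=(A,\ast,\to,\wedge,\vee,\overline{0},\overline{1})$ where $(A,\wedge,\vee,\overline{0},\overline{1})$ is a bounded lattice, $(A,\ast,\overline{1})$ is a commutative monoid, and $a\ast b\le c$ iff $a\le b\to c$; $\neg x:=x\to\overline 0$. The first-order language (without $\Delta$) has connectives $\&,\to,\wedge,\vee,\overline 0,\overline 1$ (with $\neg\varphi := \varphi\to\overline 0$, $\varphi^2:=\varphi\,\&\,\varphi$) and quantifiers $\forall,\exists$, over the full vocabulary: countably many constant symbols, predicate symbols and function symbols. For an MTL-chain $\mathbf{A}$, an $\mathbf{A}$-structure $\mathbf{M}$ consists of a nonempty domain $M$, elements of $M$ for constants, crisp functions $M^n\to M$ for $n$-ary function symbols, and maps $M^n\to A$ for $n$-ary predicate symbols; truth values $\|\cdot\|^{\mathbf{A}}_{\mathbf{M}}$ interpret connectives by the corresponding operations, $\forall$ by infimum and $\exists$ by supremum. $\mathrm{TAUT}_0(\mathbb{K})$ is the set of sentences $\psi$ with $\|\psi\|^{\mathbf{A}}_{\mathbf{M}}=\overline 0^{\mathbf{A}}$ for all $\mathbf{A}\in\mathbb{K}$ and all $\mathbf{A}$-structures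 $\mathbf{M}$. A literal is an atomic formula or the negation of an atomic formula; a lattice combination of literals is a formula built from literals using only $\wedge$ and $\vee$. For a classical formula $\varphi$ built from literals by $\wedge,\vee,\forall,\exists$, the formula $\varphi^\star$ is defined by: $\varphi^\star:=\varphi\,\&\,\varphi$ if $\varphi$ is a literal; $(\varphi_1\wedge\varphi_2)^\star:=\varphi_1^\star\wedge\varphi_2^\star$; $(\varphi_1\vee\varphi_2)^\star:=\varphi_1^\star\vee\varphi_2^\star$; $(\forall x\,\varphi)^\star:=\forall x\,\varphi^\star$; $(\exists x\,\varphi)^\star:=\exists x\,\varphi^\star$. -}

module Defs where

open import Data.Nat using (ℕ; _≟_)
open import Data.Bool using (Bool; true; false; not; _∧_; _∨_)
open import Data.Vec using (Vec; []; _∷_)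
open import Data.List using (List; []; _∷_)
open import Data.List.Membership.Propositional using (_∈_)
open import Data.Product using (Σ; _×_; _,_; ∃; ∃-syntax)
open import Data.Empty using (⊥)
open import Data.Sum using (_⊎_)
open import Relation.Nullary using (¬_; yes; no)
open import Relation.Binary.PropositionalEquality using (_≡_; _≢_)

record MTLChain : Set₁ where
  field
    Carrier : Set
    _≤_     : Carrier → Carrier → Set
    ≤-refl    : ∀ {x} → x ≤ x
    ≤-trans   : ∀ {x y z} → x ≤ y → y ≤ z → x ≤ z
    ≤-antisym : ∀ {x y} → x ≤ y → y ≤ x → x ≡ y
    ≤-total   : ∀ x y → (x ≤ y) ⊎ (y ≤ x)
    _⊓_ _⊔_   : Carrier → Carrier → Carrier
    0̄ 1̄       : Carrier
    ⊓-lb₁     : ∀ x y → (x ⊓ y) ≤ x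
    ⊓-lb₂     : ∀ x y → (x ⊓ y) ≤ y
    ⊓-glb     : ∀ {x y z} → z ≤ x → z ≤ y → z ≤ (x ⊓ y)
    ⊔-ub₁     : ∀ x y → x ≤ (x ⊔ y)
    ⊔-ub₂     : ∀ x y → y ≤ (x ⊔ y)
    ⊔-lub     : ∀ {x y z} → x ≤ z → y ≤ z → (x ⊔ y) ≤ z
    0̄-least   : ∀ x → 0̄ ≤ x
    1̄-greatest : ∀ x → x ≤ 1̄
    _*_       : Carrier → Carrier → Carrier
    *-comm    : ∀ x y → (x * y) ≡ (y * x)
    *-assoc   : ∀ x y z → ((x * y) * z) ≡ (x * (y * z))
    *-identity : ∀ x → (x * 1̄) ≡ x
    _⇒_       : Carrier → Carrier → Carrier
    resid→    : ∀ {a b c} → (a * b) ≤ c → a ≤ (b ⇒ c)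
    resid←    : ∀ {a b c} → a ≤ (b ⇒ c) → (a * b) ≤ c

-- Syntax: variables are natural numbers; for every arity n there are
-- countably many function symbols and predicate symbols (indexed by ℕ);
-- countably many constant symbols.

data Term : Set where
  var   : ℕ → Term
  const : ℕ → Term
  fun   : (n k : ℕ) → Vec Term n → Term

data Formula : Set where
  atom  : (n k : ℕ) → Vec Term n → Formula
  `0 `1 : Formula
  _`&_ _`⇒_ _`∧_ _`∨_ : Formula → Formula → Formula
  `∀ `∃ : ℕ → Formula → Formula

`¬ : Formula → Formula
`¬ φ = φ `⇒ `0

-- Free variables: WF Γ φ means every free variable of φ lies in Γ.

mutual
  data TermWF (Γ : List ℕ) : Term → Set where
    var   : ∀ {x} → x ∈ Γ → TermWF Γ (var x)
    const : ∀ {c} → TermWF Γ (const c)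
    fun   : ∀ {n k ts} → TermsWF Γ ts → TermWF Γ (fun n k ts)

  data TermsWF (Γ : List ℕ) : ∀ {n} → Vec Term n → Set where
    []  : TermsWF Γ []
    _∷_ : ∀ {n t} {ts : Vec Term n} → TermWF Γ t → TermsWF Γ ts → TermsWF Γ (t ∷ ts)

data WF (Γ : List ℕ) : Formula → Set where
  atom : ∀ {n k ts} → TermsWF Γ ts → WF Γ (atom n k ts)
  `0   : WF Γ `0
  `1   : WF Γ `1
  _`&_ : ∀ {φ ψ} → WF Γ φ → WF Γ ψ → WF Γ (φ `& ψ)
  _`⇒_ : ∀ {φ ψ} → WF Γ φ → WF Γ ψ → WF Γ (φ `⇒ ψ)
  _`∧_ : ∀ {φ ψ} → WF Γ φ → WF Γ ψ → WF Γ (φ `∧ ψ)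
  _`∨_ : ∀ {φ ψ} → WF Γ φ → WF Γ ψ → WF Γ (φ `∨ ψ)
  `∀   : ∀ {x φ} → WF (x ∷ Γ) φ → WF Γ (`∀ x φ)
  `∃   : ∀ {x φ} → WF (x ∷ Γ) φ → WF Γ (`∃ x φ)

Sentence : Formula → Set
Sentence φ = WF [] φ

-- Since an arbitrary MTL-chain
-- need not be complete, the semantics is given as a relation
-- Val M e φ a  ("φ has truth value a in M under e"), where ∀/∃ take the
-- infimum/supremum when it exists.

record Structure (A : MTLChain) : Set₁ where
  open MTLChain A
  field
    Dom    : Set
    point  : Dom          -- nonempty domain
    constᴹ : ℕ → Dom
    funᴹ   : (n k : ℕ) → Vec Dom n → Dom
    predᴹ  : (n k : ℕ) → Vec Dom n → Carrier

module Semantics {A : MTLChain} (M : Structure A) where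
  open MTLChain A
  open Structure M

  Env : Set
  Env = ℕ → Dom

  update : Env → ℕ → Dom → Env
  update e x d y with y ≟ x
  ... | yes _ = d
  ... | no  _ = e y

  mutual
    evalTerm : Env → Term → Dom
    evalTerm e (var x)      = e x
    evalTerm e (const c)    = constᴹ c
    evalTerm e (fun n k ts) = funᴹ n k (evalTerms e ts)

    evalTerms : ∀ {n} → Env → Vec Term n → Vec Dom n
    evalTerms e []       = []
    evalTerms e (t ∷ ts) = evalTerm e t ∷ evalTerms e ts

  IsInf : (Dom → Carrier) → Carrier → Set
  IsInf f a = (∀ d → a ≤ f d) × (∀ b → (∀ d → b ≤ f d) → b ≤ a)

  IsSup : (Dom → Carrier) → Carrier → Set
  IsSup f a = (∀ d → f d ≤ a) × (∀ b → (∀ d → f d ≤ b) → a ≤ b)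

  data Val (e : Env) : Formula → Carrier → Set where
    atom : ∀ {n k ts} → Val e (atom n k ts) (predᴹ n k (evalTerms e ts))
    `0   : Val e `0 0̄
    `1   : Val e `1 1̄
    _`&_ : ∀ {φ ψ a b} → Val e φ a → Val e ψ b → Val e (φ `& ψ) (a * b)
    _`⇒_ : ∀ {φ ψ a b} → Val e φ a → Val e ψ b → Val e (φ `⇒ ψ) (a ⇒ b)
    _`∧_ : ∀ {φ ψ a b} → Val e φ a → Val e ψ b → Val e (φ `∧ ψ) (a ⊓ b)
    _`∨_ : ∀ {φ ψ a b} → Val e φ a → Val e ψ b → Val e (φ `∨ ψ) (a ⊔ b)
    `∀   : ∀ {x φ a} (f : Dom → Carrier) →
           (∀ d → Val (update e x d) φ (f d)) → IsInf f a → Val e (`∀ x φ) a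
    `∃   : ∀ {x φ a} (f : Dom → Carrier) →
           (∀ d → Val (update e x d) φ (f d)) → IsSup f a → Val e (`∃ x φ) a

Class : Set₂
Class = MTLChain → Set₁

NonTrivial : Class → Set₁
NonTrivial K = Σ MTLChain λ A →
  K A × Σ (MTLChain.Carrier A) λ a → Σ (MTLChain.Carrier A) λ b → a ≢ b

TAUT₀ : Class → Formula → Set₁
TAUT₀ K ψ = Sentence ψ ×
  (∀ (A : MTLChain) → K A → (M : Structure A) →
     ∀ e a → Semantics.Val M e ψ a → a ≡ MTLChain.0̄ A)

data Literal : Formula → Set where
  pos : ∀ {n k ts} → Literal (atom n k ts)
  neg : ∀ {n k ts} → Literal (`¬ (atom n k ts))

data LatComb : Formula → Set where
  lit  : ∀ {φ} → Literal φ → LatComb φ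
  _`∧_ : ∀ {φ ψ} → LatComb φ → LatComb ψ → LatComb (φ `∧ ψ)
  _`∨_ : ∀ {φ ψ} → LatComb φ → LatComb ψ → LatComb (φ `∨ ψ)

star : ∀ {φ} → LatComb φ → Formula
star {φ} (lit _)  = φ `& φ
star (l `∧ r) = star l `∧ star r
star (l `∨ r) = star l `∨ star r

-- Propositional valuation: each atomic sentence (syntactically distinct)
-- is an independent propositional variable.
PropValuation : Set
PropValuation = (n k : ℕ) → Vec Term n → Bool

evalLit : ∀ {φ} → PropValuation → Literal φ → Bool
evalLit v (pos {n} {k} {ts}) = v n k ts
evalLit v (neg {n} {k} {ts}) = not (v n k ts)

evalClassical : ∀ {φ} → PropValuation → LatComb φ → Bool
evalClassical v (lit l)  = evalLit v l
evalClassical v (l `∧ r) = evalClassical v l ∧ evalClassical v r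
evalClassical v (l `∨ r) = evalClassical v l ∨ evalClassical v r

ClassicalContradiction : ∀ {φ} → LatComb φ → Set
ClassicalContradiction c = ∀ v → evalClassical v c ≡ false

-- In an MTL-chain every element a satisfies a ≤ ¬a or ¬a ≤ a, so either a² = 0
-- or (¬a)² = 0.  Reading the first case as "a false" and the second as "a true"
-- turns any structure into a classical valuation under which every classically
-- false literal ℓ has ℓ² = 0; hence a contradiction φ gets φ⋆ = 0 everywhere.
-- Conversely {0̄, 1̄} is a two-element Boolean subalgebra of any non-trivial
-- chain, so a classical valuation making φ true yields a term model in which φ⋆
-- takes the value 1̄ ≠ 0̄.
module Submission where

open import Defs
open import Function.Bundles using (_⇔_; mk⇔)
open import Data.Bool using (Bool; true; false; not; _∧_; _∨_)
open import Data.Bool.Properties using (not-injective)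
open import Data.Vec using (Vec; []; _∷_)
open import Data.Nat using (ℕ)
open import Data.List using (List)
open import Data.Product using (_,_)
open import Data.Sum using (inj₁; inj₂)
open import Data.Empty using (⊥-elim)
open import Relation.Binary.PropositionalEquality

star-wf : ∀ {Γ : List ℕ} {φ} (c : LatComb φ) → WF Γ φ → WF Γ (star c)
star-wf (lit _)  w           = w `& w
star-wf (l `∧ r) (wl `∧ wr) = star-wf l wl `∧ star-wf r wr
star-wf (l `∨ r) (wl `∨ wr) = star-wf l wl `∨ star-wf r wr

module MTLChainProperties (A : MTLChain) where
  open MTLChain A

  ≤-reflexive : ∀ {x y} → x ≡ y → x ≤ y
  ≤-reflexive refl = ≤-refl

  x≤0⇒x≡0 : ∀ {x} → x ≤ 0̄ → x ≡ 0̄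
  x≤0⇒x≡0 x≤0 = ≤-antisym x≤0 (0̄-least _)

  1≤x⇒x≡1 : ∀ {x} → 1̄ ≤ x → x ≡ 1̄
  1≤x⇒x≡1 1≤x = ≤-antisym (1̄-greatest _) 1≤x

  *-monoˡ-≤ : ∀ {x y} z → x ≤ y → (x * z) ≤ (y * z)
  *-monoˡ-≤ z x≤y = resid← (≤-trans x≤y (resid→ ≤-refl))

  *-identityˡ : ∀ x → (1̄ * x) ≡ x
  *-identityˡ x = trans (*-comm 1̄ x) (*-identity x)

  x*¬x≤0 : ∀ x → (x * (x ⇒ 0̄)) ≤ 0̄
  x*¬x≤0 x = subst (_≤ 0̄) (*-comm (x ⇒ 0̄) x) (resid← ≤-refl)

  ¬x*x≤0 : ∀ x → ((x ⇒ 0̄) * x) ≤ 0̄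
  ¬x*x≤0 x = resid← ≤-refl

  0≢1 : ∀ {x y : Carrier} → x ≢ y → 0̄ ≢ 1̄
  0≢1 {x} {y} x≢y 0≡1 = x≢y (trans (collapse x) (sym (collapse y)))
    where
    collapse : ∀ z → z ≡ 0̄
    collapse z = x≤0⇒x≡0 (subst (z ≤_) (sym 0≡1) (1̄-greatest z))

  classical : Carrier → Bool
  classical x with ≤-total x (x ⇒ 0̄)
  ... | inj₁ _ = false
  ... | inj₂ _ = true

  classical-false⇒x²≤0 : ∀ x → classical x ≡ false → (x * x) ≤ 0̄
  classical-false⇒x²≤0 x _ with ≤-total x (x ⇒ 0̄)
  ... | inj₁ x≤¬x = ≤-trans (*-monoˡ-≤ x x≤¬x) (¬x*x≤0 x)

  classical-true⇒¬x²≤0 : ∀ x → classical x ≡ true → ((x ⇒ 0̄) * (x ⇒ 0̄)) ≤ 0̄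
  classical-true⇒¬x²≤0 x _ with ≤-total x (x ⇒ 0̄)
  ... | inj₂ ¬x≤x = ≤-trans (*-monoˡ-≤ (x ⇒ 0̄) ¬x≤x) (x*¬x≤0 x)

  ⊓-zeroˡ : ∀ {x} y → x ≡ 0̄ → (x ⊓ y) ≡ 0̄
  ⊓-zeroˡ y refl = x≤0⇒x≡0 (⊓-lb₁ _ y)

  ⊓-zeroʳ : ∀ x {y} → y ≡ 0̄ → (x ⊓ y) ≡ 0̄
  ⊓-zeroʳ x refl = x≤0⇒x≡0 (⊓-lb₂ x _)

  ⊔-zero : ∀ {x y} → x ≡ 0̄ → y ≡ 0̄ → (x ⊔ y) ≡ 0̄
  ⊔-zero refl refl = x≤0⇒x≡0 (⊔-lub ≤-refl ≤-refl)

  ⟦_⟧ : Bool → Carrier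
  ⟦ false ⟧ = 0̄
  ⟦ true  ⟧ = 1̄

  ⟦⟧-square : ∀ b → (⟦ b ⟧ * ⟦ b ⟧) ≡ ⟦ b ⟧
  ⟦⟧-square false = x≤0⇒x≡0 (subst ((0̄ * 0̄) ≤_) (*-identityˡ 0̄) (*-monoˡ-≤ 0̄ (0̄-least 1̄)))
  ⟦⟧-square true  = *-identity 1̄

  ⟦⟧-not : ∀ b → (⟦ b ⟧ ⇒ 0̄) ≡ ⟦ not b ⟧
  ⟦⟧-not false = 1≤x⇒x≡1 (resid→ (≤-reflexive (*-identityˡ 0̄)))
  ⟦⟧-not true  = x≤0⇒x≡0 (subst (_≤ 0̄) (*-identity (1̄ ⇒ 0̄)) (¬x*x≤0 1̄))

  ⟦⟧-∧ : ∀ b c → (⟦ b ⟧ ⊓ ⟦ c ⟧) ≡ ⟦ b ∧ c ⟧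
  ⟦⟧-∧ false c = ⊓-zeroˡ ⟦ c ⟧ refl
  ⟦⟧-∧ true  c = ≤-antisym (⊓-lb₂ 1̄ ⟦ c ⟧) (⊓-glb (1̄-greatest _) ≤-refl)

  ⟦⟧-∨ : ∀ b c → (⟦ b ⟧ ⊔ ⟦ c ⟧) ≡ ⟦ b ∨ c ⟧
  ⟦⟧-∨ false c = ≤-antisym (⊔-lub (0̄-least _) ≤-refl) (⊔-ub₂ 0̄ ⟦ c ⟧)
  ⟦⟧-∨ true  c = 1≤x⇒x≡1 (⊔-ub₁ 1̄ ⟦ c ⟧)

  ⟦⟧≡0⇒false : 0̄ ≢ 1̄ → ∀ {b} → ⟦ b ⟧ ≡ 0̄ → b ≡ false
  ⟦⟧≡0⇒false _   {false} _   = refl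
  ⟦⟧≡0⇒false 0≢1 {true}  1≡0 = ⊥-elim (0≢1 (sym 1≡0))

module InducedValuation {A : MTLChain} (M : Structure A) (e : Semantics.Env M) where
  open MTLChain A
  open MTLChainProperties A
  open Structure M
  open Semantics M

  induced : PropValuation
  induced n k ts = classical (predᴹ n k (evalTerms e ts))

  star-false⇒0 : ∀ {φ} (c : LatComb φ) {x} → Val e (star c) x →
                 evalClassical induced c ≡ false → x ≡ 0̄
  star-false⇒0 (lit pos) (atom `& atom) c-false =
    x≤0⇒x≡0 (classical-false⇒x²≤0 _ c-false)
  star-false⇒0 (lit neg) ((atom `⇒ `0) `& (atom `⇒ `0)) c-false =
    x≤0⇒x≡0 (classical-true⇒¬x²≤0 _ (not-injective c-false))
  star-false⇒0 (l `∧ r) (vl `∧ vr) c-false with evalClassical induced l in l-false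
  ... | false = ⊓-zeroˡ _ (star-false⇒0 l vl l-false)
  ... | true  = ⊓-zeroʳ _ (star-false⇒0 r vr c-false)
  star-false⇒0 (l `∨ r) (vl `∨ vr) c-false with evalClassical induced l in l-false
  ... | false = ⊔-zero (star-false⇒0 l vl l-false) (star-false⇒0 r vr c-false)

module TermModel (A : MTLChain) (v : PropValuation) where
  open MTLChain A
  open MTLChainProperties A

  termModel : Structure A
  termModel = record
    { Dom    = Term
    ; point  = const 0
    ; constᴹ = const
    ; funᴹ   = fun
    ; predᴹ  = λ n k ts → ⟦ v n k ts ⟧
    }

  open Semantics termModel

  mutual
    evalTerm-var : ∀ t → evalTerm var t ≡ t
    evalTerm-var (var x)      = refl
    evalTerm-var (const c)    = refl
    evalTerm-var (fun n k ts) = cong (fun n k) (evalTerms-var ts)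

    evalTerms-var : ∀ {n} (ts : Vec Term n) → evalTerms var ts ≡ ts
    evalTerms-var []       = refl
    evalTerms-var (t ∷ ts) = cong₂ _∷_ (evalTerm-var t) (evalTerms-var ts)

  atom-val : ∀ {n k ts} → Val var (atom n k ts) ⟦ v n k ts ⟧
  atom-val {n} {k} {ts} =
    subst (λ us → Val var (atom n k ts) ⟦ v n k us ⟧) (evalTerms-var ts) atom

  star-val : ∀ {φ} (c : LatComb φ) → Val var (star c) ⟦ evalClassical v c ⟧
  star-val (lit (pos {n} {k} {ts})) =
    subst (Val var _) (⟦⟧-square (v n k ts)) (atom-val `& atom-val)
  star-val (lit (neg {n} {k} {ts})) =
    subst (Val var _) (trans (cong₂ _*_ (⟦⟧-not b) (⟦⟧-not b)) (⟦⟧-square (not b)))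
          ((atom-val `⇒ `0) `& (atom-val `⇒ `0))
    where
    b : Bool
    b = v n k ts
  star-val (l `∧ r) = subst (Val var _) (⟦⟧-∧ (evalClassical v l) (evalClassical v r)) (star-val l `∧ star-val r)
  star-val (l `∨ r) = subst (Val var _) (⟦⟧-∨ (evalClassical v l) (evalClassical v r)) (star-val l `∨ star-val r)

mainTheorem3 : (K : Class) → NonTrivial K →
    (φ : Formula) → Sentence φ → (c : LatComb φ) →
    ClassicalContradiction c ⇔ TAUT₀ K (star c)
mainTheorem3 K (A , A∈K , x , y , x≢y) φ φ-sentence c = mk⇔ sound complete
  where
  sound : ClassicalContradiction c → TAUT₀ K (star c)
  sound contra = star-wf c φ-sentence , λ B _ M e _ val →
    InducedValuation.star-false⇒0 M e c val (contra _)

  complete : TAUT₀ K (star c) → ClassicalContradiction c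
  complete (_ , taut) v =
    ⟦⟧≡0⇒false (0≢1 x≢y) (taut A A∈K termModel var _ (star-val c))
    where
    open MTLChainProperties A
    open TermModel A v
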